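{- Let $n\geq1$ and let $X,Y,Z$ be finite abelian groups with a $\bm{\mu}_{n}$-action making them finite free pointed $\bm{\mu}_{n}$-sets (marked points being the identity elements). Let $0\rightarrow X\rightarrow Y\rightarrow Z\rightarrow 0$ be an exact sequence of abelian groups with $\bm{\mu}_{n}$-equivariant maps. Then there is a canonical isomorphism $\det(X)\otimes\det(Z)=\det(Y)$.
   Context: $\bm{\mu}_n$ is the cyclic group of $n$-th roots of unity. A finite free pointed $\bm{\mu}_n$-set is a finite pointed set $(X,*)$ with a $\bm{\mu}_n$-action fixing $*$ and free on $\tilde X=X\smallsetminus\{*\}$. A $\bm{\mu}_n$-line is a set with a free transitive $\bm{\mu}_n$-action; $L\otimes M$ is $L\times M$ modulo $(\mu l,m)\sim(l,\mu m)$; for pointed $\bm{\mu}_n$-sets $X,Y$ with $\tilde X,\tilde Y$ lines, $X\otimes Y=\{*\}\sqcup(\tilde X\otimes\tilde Y)$. If the orbits of $\tilde X$ are $L_1,\dots,L_t$, $\det(X)=\{*\}\sqcup(L_1\otimes\cdots\otimes L_t)$, the empty tensor product being $\bm{\mu}_n$. -}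

module Defs where

open import Data.Nat using (ℕ; zero; suc; NonZero) renaming (_+_ to _+ℕ_; _∸_ to _∸ℕ_)
open import Data.Nat.DivMod using (_mod_)
open import Data.Fin using (Fin; toℕ) renaming (zero to fzero; suc to fsuc)
open import Data.Fin.Properties using (inj⇒≟)
open import Data.Maybe using (Maybe; just; nothing)
open import Data.Product using (Σ; ∃; _×_; _,_; proj₁; proj₂)
open import Data.Empty using (⊥)
open import Data.Unit using (⊤)
open import Relation.Nullary using (¬_; Dec; yes; no)
open import Relation.Binary.PropositionalEquality using (_≡_; _≢_; refl; sym; trans; cong)
open import Relation.Binary.Definitions using (DecidableEquality)
open import Algebra.Structures using (IsAbelianGroup)
open import Function.Bundles using (_↔_)
open import Function.Properties.Inverse using (↔⇒↣)

-- μ_n, the cyclic group of n-th roots of unity, modelled as ℤ/n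
-- (written additively on Fin n): ζ ↔ exponent of a fixed primitive root.

μ : (n : ℕ) → Set
μ n = Fin n

module _ {n : ℕ} .{{nz : NonZero n}} where

  _·μ_ : μ n → μ n → μ n
  a ·μ b = (toℕ a +ℕ toℕ b) mod n

  1μ : μ n
  1μ = 0 mod n

  μ⁻¹ : μ n → μ n
  μ⁻¹ a = (n ∸ℕ toℕ a) mod n

  prodμ : (k : ℕ) → (Fin k → μ n) → μ n
  prodμ zero    _ = 1μ
  prodμ (suc k) d = d fzero ·μ prodμ k (λ i → d (fsuc i))

record FinAbMuGroup (n : ℕ) .{{nz : NonZero n}} : Set₁ where
  field
    Carrier        : Set
    _+_            : Carrier → Carrier → Carrier
    0#             : Carrier
    -_             : Carrier → Carrier
    isAbelianGroup : IsAbelianGroup _≡_ _+_ 0# -_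
    size           : ℕ
    finite         : Carrier ↔ Fin size
    act            : μ n → Carrier → Carrier
    act-unit       : ∀ x → act 1μ x ≡ x
    act-comp       : ∀ ζ ξ x → act (ζ ·μ ξ) x ≡ act ζ (act ξ x)
    act-hom        : ∀ ζ x y → act ζ (x + y) ≡ act ζ x + act ζ y
    act-pt         : ∀ ζ → act ζ 0# ≡ 0#
    act-free       : ∀ ζ x → x ≢ 0# → act ζ x ≡ x → ζ ≡ 1μ

  _≟_ : DecidableEquality Carrier
  _≟_ = inj⇒≟ (↔⇒↣ finite)

  enum : Fin size → Carrier
  enum = Function.Bundles.Inverse.from finite

-- An element of L_1 ⊗ ... ⊗ L_t (tensor over the orbits of X∖{0})
-- is represented by an element of the product Π_O O, i.e. a choice of one
-- point in each orbit (a "section"), modulo moving roots of unity between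
-- factors.  To also cover the empty tensor product (= μ_n) we use the
-- canonically isomorphic μ_n ⊗ L_1 ⊗ ... ⊗ L_t, i.e. pairs (ζ , s).

module _ {n : ℕ} .{{nz : NonZero n}} (X : FinAbMuGroup n) where
  open FinAbMuGroup X

  record Section : Set where
    field
      sec       : Carrier → Carrier
      sec-orbit : ∀ x → ∃ λ ζ → sec x ≡ act ζ x
      sec-const : ∀ ζ x → sec (act ζ x) ≡ sec x
  open Section public

  isRep? : (s : Section) (x : Carrier) → Dec ((x ≢ 0#) × (sec s x ≡ x))
  isRep? s x with x ≟ 0# | sec s x ≟ x
  ... | yes p | _     = no (λ q → proj₁ q p)
  ... | no p  | yes q = yes (p , q)
  ... | no p  | no q  = no (λ r → q (proj₂ r))

  prodOverOrbits : Section → (Carrier → μ n) → μ n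
  prodOverOrbits s d = prodμ size (λ i → f (enum i) (isRep? s (enum i)))
    where
      f : (x : Carrier) → Dec ((x ≢ 0#) × (sec s x ≡ x)) → μ n
      f x (yes _) = d x
      f x (no _)  = 1μ

  DetLine : Set
  DetLine = μ n × Section

  _≈Line_ : DetLine → DetLine → Set
  (ζ , s) ≈Line (ζ' , s') =
    ∃ λ (d : Carrier → μ n) →
      (∀ x → sec s' x ≡ act (d x) (sec s x)) × (ζ ≡ ζ' ·μ prodOverOrbits s d)

  actLine : μ n → DetLine → DetLine
  actLine ξ (ζ , s) = (ξ ·μ ζ , s)

record PtMuSetoid (n : ℕ) .{{nz : NonZero n}} : Set₁ where
  field
    Elt  : Set
    _≈_  : Elt → Elt → Set
    pt   : Elt
    actE : μ n → Elt → Elt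

record PtMuIso {n : ℕ} .{{nz : NonZero n}} (A B : PtMuSetoid n) : Set where
  private
    module A = PtMuSetoid A
    module B = PtMuSetoid B
  field
    to        : A.Elt → B.Elt
    from      : B.Elt → A.Elt
    to-cong   : ∀ {a a'} → a A.≈ a' → to a B.≈ to a'
    from-cong : ∀ {b b'} → b B.≈ b' → from b A.≈ from b'
    to-from   : ∀ b → to (from b) B.≈ b
    from-to   : ∀ a → from (to a) A.≈ a
    to-pt     : to A.pt B.≈ B.pt
    to-equiv  : ∀ ζ a → to (A.actE ζ a) B.≈ B.actE ζ (to a)

MaybeRel : {A : Set} → (A → A → Set) → Maybe A → Maybe A → Set
MaybeRel R nothing  nothing  = ⊤
MaybeRel R nothing  (just _) = ⊥
MaybeRel R (just _) nothing  = ⊥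
MaybeRel R (just a) (just b) = R a b

mapMaybe : {A B : Set} → (A → B) → Maybe A → Maybe B
mapMaybe f nothing  = nothing
mapMaybe f (just a) = just (f a)

-- det(X) = {*} ⊔ (L_1 ⊗ ... ⊗ L_t)
Det : {n : ℕ} .{{nz : NonZero n}} → FinAbMuGroup n → PtMuSetoid n
Det X = record
  { Elt  = Maybe (DetLine X)
  ; _≈_  = MaybeRel (_≈Line_ X)
  ; pt   = nothing
  ; actE = λ ζ → mapMaybe (actLine X ζ)
  }

-- det(X) ⊗ det(Z) = {*} ⊔ (L ⊗ M), with (a , b) ~ (a' , b') iff
-- a' ≈ ξ a and b ≈ ξ b' for some ξ ∈ μ_n (i.e. (ξ a , b') = (a , ξ b')).
_⊗Det_ : {n : ℕ} .{{nz : NonZero n}} → FinAbMuGroup n → FinAbMuGroup n → PtMuSetoid n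
X ⊗Det Z = record
  { Elt  = Maybe (DetLine X × DetLine Z)
  ; _≈_  = MaybeRel (λ { (a , b) (a' , b') →
             ∃ λ ξ → _≈Line_ X a' (actLine X ξ a) × _≈Line_ Z b (actLine Z ξ b') })
  ; pt   = nothing
  ; actE = λ ζ → mapMaybe (λ { (a , b) → (actLine X ζ a , b) })
  }

record SES (n : ℕ) .{{nz : NonZero n}} : Set₁ where
  field
    X Y Z : FinAbMuGroup n
  private
    module X = FinAbMuGroup X
    module Y = FinAbMuGroup Y
    module Z = FinAbMuGroup Z
  field
    f       : X.Carrier → Y.Carrier
    g       : Y.Carrier → Z.Carrier
    f-hom   : ∀ a b → f (a X.+ b) ≡ f a Y.+ f b
    g-hom   : ∀ a b → g (a Y.+ b) ≡ g a Z.+ g b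
    f-equiv : ∀ ζ x → f (X.act ζ x) ≡ Y.act ζ (f x)
    g-equiv : ∀ ζ y → g (Y.act ζ y) ≡ Z.act ζ (g y)
    f-inj   : ∀ a b → f a ≡ f b → a ≡ b
    im⊆ker  : ∀ x → g (f x) ≡ Z.0#
    ker⊆im  : ∀ y → g y ≡ Z.0# → ∃ λ x → f x ≡ y
    g-surj  : ∀ z → ∃ λ y → g y ≡ z

record MuGroupIso {n : ℕ} .{{nz : NonZero n}} (A B : FinAbMuGroup n) : Set where
  private
    module A = FinAbMuGroup A
    module B = FinAbMuGroup B
  field
    to       : A.Carrier → B.Carrier
    from     : B.Carrier → A.Carrier
    to-from  : ∀ b → to (from b) ≡ b
    from-to  : ∀ a → from (to a) ≡ a
    to-hom   : ∀ a a' → to (a A.+ a') ≡ to a B.+ to a'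
    to-equiv : ∀ ζ a → to (A.act ζ a) ≡ B.act ζ (to a)

module _ {n : ℕ} .{{nz : NonZero n}} {A B : FinAbMuGroup n} (φ : MuGroupIso A B) where
  private
    module A = FinAbMuGroup A
    module B = FinAbMuGroup B
    open MuGroupIso φ

  from-equiv : ∀ ζ b → from (B.act ζ b) ≡ A.act ζ (from b)
  from-equiv ζ b = trans (cong (λ u → from (B.act ζ u)) (sym (to-from b)))
                         (trans (cong from (sym (to-equiv ζ (from b))))
                                (from-to (A.act ζ (from b))))

  transportSection : Section A → Section B
  transportSection s = record
    { sec       = λ b → to (sec s (from b))
    ; sec-orbit = λ b → proj₁ (sec-orbit s (from b)) ,
        trans (cong to (proj₂ (sec-orbit s (from b))))
              (trans (to-equiv _ (from b)) (cong (B.act _) (to-from b)))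
    ; sec-const = λ ζ b → cong to (trans (cong (sec s) (from-equiv ζ b))
                                         (sec-const s ζ (from b)))
    }

  detLineMap : DetLine A → DetLine B
  detLineMap (ζ , s) = (ζ , transportSection s)

  detMap : Maybe (DetLine A) → Maybe (DetLine B)
  detMap = mapMaybe detLineMap

tensorDetMap : {n : ℕ} .{{nz : NonZero n}} {X X' Z Z' : FinAbMuGroup n} →
  MuGroupIso X X' → MuGroupIso Z Z' →
  Maybe (DetLine X × DetLine Z) → Maybe (DetLine X' × DetLine Z')
tensorDetMap α γ = mapMaybe (λ { (a , b) → (detLineMap α a , detLineMap γ b) })

record SESIso {n : ℕ} .{{nz : NonZero n}} (E E' : SES n) : Set where
  private
    module E  = SES E
    module E' = SES E'
  field
    α : MuGroupIso E.X E'.X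
    β : MuGroupIso E.Y E'.Y
    γ : MuGroupIso E.Z E'.Z
    sq-f : ∀ x → E'.f (MuGroupIso.to α x) ≡ MuGroupIso.to β (E.f x)
    sq-g : ∀ y → E'.g (MuGroupIso.to β y) ≡ MuGroupIso.to γ (E.g y)

-- A canonical isomorphism det(X) ⊗ det(Z) ≅ det(Y): a family of
-- isomorphisms, one for each short exact sequence, natural with respect
-- to isomorphisms of short exact sequences.

CanonicalDetIso : (n : ℕ) .{{nz : NonZero n}} → Set₁
CanonicalDetIso n =
  Σ ((E : SES n) → PtMuIso (SES.X E ⊗Det SES.Z E) (Det (SES.Y E))) λ Φ →
    ∀ (E E' : SES n) (φ : SESIso E E') (u : Maybe (DetLine (SES.X E) × DetLine (SES.Z E))) →
      MaybeRel (_≈Line_ (SES.Y E'))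
        (detMap (SESIso.β φ) (PtMuIso.to (Φ E) u))
        (PtMuIso.to (Φ E') (tensorDetMap (SESIso.α φ) (SESIso.γ φ) u))

{-# OPTIONS --safe #-}
-- A point of det(X) is a root of unity together with a section s choosing one point in each
-- orbit of X ∖ {0}; changing s to s′ is compensated by the factor δ s s′, the product over the
-- orbits of the roots of unity moving s to s′. Sections s of X and t of Z glue to a section of Y:
-- f ∘ s on the kernel of g, and over a point z ≠ 0 the root of unity moving z to t z. The
-- isomorphism sends (ζ , s) ⊗ (ξ , t) to (ζ ξ , glue s t); it is well defined because δ is
-- multiplicative on glued sections. There the Z-factor appears once for each of the |X| points
-- of a fibre of g, and |X| ≡ 1 (mod n) since X ∖ {0} is a union of free orbits. Naturality holds
-- because gluing commutes with transport along isomorphisms of exact sequences.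
module Submission where

open import Defs

open import Level using (0ℓ)
open import Algebra.Bundles using (AbelianGroup; CommutativeMonoid; Group)
open import Algebra.Structures using (IsAbelianGroup)
import Algebra.Properties.Group as GroupProperties
import Algebra.Properties.CommutativeMonoid.Sum as SumProperties
import Algebra.Solver.CommutativeMonoid as CommutativeMonoidSolver
open import Data.Bool using (if_then_else_)
open import Data.Empty using (⊥-elim)
open import Data.Fin using (Fin; toℕ; _↑ˡ_; _↑ʳ_; combine; remQuot) renaming (zero to fzero; suc to fsuc)
open import Data.Fin.Properties using (toℕ-fromℕ<; toℕ-injective; toℕ<n; remQuot-combine; combine-remQuot) renaming (_≟_ to _≟Fin_)
open import Data.List using (allFin)
open import Data.List.Membership.Propositional.Properties using (∈-allFin)
import Data.List.Relation.Unary.All as All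
open import Data.Maybe using (Maybe; just; nothing)
open import Data.Nat using (ℕ; NonZero; zero; suc; _%_; _+_; _*_; _∸_; _≤_)
open import Data.Nat.DivMod using (_mod_; %-distribˡ-+; m%n%n≡m%n; m<n⇒m%n≡m; [m+n]%n≡m%n)
open import Data.Nat.Properties using (+-comm; +-assoc; +-identityʳ; m+[n∸m]≡n; <⇒≤; ≤-totalOrder; ≤-antisym)
open import Data.List.Extrema ≤-totalOrder using (argmin; f[argmin]≤f[xs])
open import Data.Product using (∃; _×_; _,_; proj₁; proj₂; uncurry)
open import Data.Unit using (tt)
open import Function.Bundles using (_↔_; Inverse; mk↔ₛ′)
open import Relation.Nullary using (Dec; yes; no; does)
open import Relation.Binary.PropositionalEquality

module RootsOfUnity {n : ℕ} .{{_ : NonZero n}} where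

  mod-toℕ : ∀ (a : μ n) → toℕ a mod n ≡ a
  mod-toℕ a = toℕ-injective (trans (toℕ-fromℕ< _) (m<n⇒m%n≡m (toℕ<n a)))

  mod-cong-% : ∀ {k l} → k % n ≡ l % n → k mod n ≡ l mod n
  mod-cong-% eq = toℕ-injective (trans (toℕ-fromℕ< _) (trans eq (sym (toℕ-fromℕ< _))))

  %-absorbˡ : ∀ k l → (k % n + l) % n ≡ (k + l) % n
  %-absorbˡ k l = begin
    (k % n + l) % n         ≡⟨ %-distribˡ-+ (k % n) l n ⟩
    (k % n % n + l % n) % n ≡⟨ cong (λ v → (v + l % n) % n) (m%n%n≡m%n k n) ⟩
    (k % n + l % n) % n     ≡⟨ %-distribˡ-+ k l n ⟨
    (k + l) % n             ∎
    where open ≡-Reasoning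

  %-absorbʳ : ∀ k l → (k + l % n) % n ≡ (k + l) % n
  %-absorbʳ k l = begin
    (k + l % n) % n ≡⟨ cong (_% n) (+-comm k (l % n)) ⟩
    (l % n + k) % n ≡⟨ %-absorbˡ l k ⟩
    (l + k) % n     ≡⟨ cong (_% n) (+-comm l k) ⟩
    (k + l) % n     ∎
    where open ≡-Reasoning

  ·μ-comm : ∀ (a b : μ n) → a ·μ b ≡ b ·μ a
  ·μ-comm a b = cong (_mod n) (+-comm (toℕ a) (toℕ b))

  ·μ-assoc : ∀ (a b c : μ n) → (a ·μ b) ·μ c ≡ a ·μ (b ·μ c)
  ·μ-assoc a b c = mod-cong-% (begin
    (toℕ (a ·μ b) + toℕ c) % n        ≡⟨ cong (λ v → (v + toℕ c) % n) (toℕ-fromℕ< _) ⟩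
    ((toℕ a + toℕ b) % n + toℕ c) % n ≡⟨ %-absorbˡ (toℕ a + toℕ b) (toℕ c) ⟩
    (toℕ a + toℕ b + toℕ c) % n       ≡⟨ cong (_% n) (+-assoc (toℕ a) (toℕ b) (toℕ c)) ⟩
    (toℕ a + (toℕ b + toℕ c)) % n     ≡⟨ %-absorbʳ (toℕ a) (toℕ b + toℕ c) ⟨
    (toℕ a + (toℕ b + toℕ c) % n) % n ≡⟨ cong (λ v → (toℕ a + v) % n) (toℕ-fromℕ< _) ⟨
    (toℕ a + toℕ (b ·μ c)) % n        ∎)
    where open ≡-Reasoning

  ·μ-identityʳ : ∀ (a : μ n) → a ·μ 1μ ≡ a
  ·μ-identityʳ a = trans (mod-cong-% (begin
    (toℕ a + toℕ (1μ {n})) % n ≡⟨ cong (λ v → (toℕ a + v) % n) (toℕ-fromℕ< _) ⟩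
    (toℕ a + 0 % n) % n        ≡⟨ %-absorbʳ (toℕ a) 0 ⟩
    (toℕ a + 0) % n            ≡⟨ cong (_% n) (+-identityʳ (toℕ a)) ⟩
    toℕ a % n                  ∎)) (mod-toℕ a)
    where open ≡-Reasoning

  ·μ-inverseʳ : ∀ (a : μ n) → a ·μ μ⁻¹ a ≡ 1μ
  ·μ-inverseʳ a = mod-cong-% (begin
    (toℕ a + toℕ (μ⁻¹ a)) % n     ≡⟨ cong (λ v → (toℕ a + v) % n) (toℕ-fromℕ< _) ⟩
    (toℕ a + (n ∸ toℕ a) % n) % n ≡⟨ %-absorbʳ (toℕ a) (n ∸ toℕ a) ⟩
    (toℕ a + (n ∸ toℕ a)) % n     ≡⟨ cong (_% n) (m+[n∸m]≡n (<⇒≤ (toℕ<n a))) ⟩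
    n % n                         ≡⟨ [m+n]%n≡m%n 0 n ⟩
    0 % n                         ∎)
    where open ≡-Reasoning

  μ-abelianGroup : AbelianGroup 0ℓ 0ℓ
  μ-abelianGroup = record
    { Carrier = μ n ; _≈_ = _≡_ ; _∙_ = _·μ_ ; ε = 1μ ; _⁻¹ = μ⁻¹
    ; isAbelianGroup = record
      { isGroup = record
        { isMonoid = record
          { isSemigroup = record
            { isMagma = record { isEquivalence = isEquivalence ; ∙-cong = cong₂ _·μ_ }
            ; assoc = ·μ-assoc }
          ; identity = (λ a → trans (·μ-comm 1μ a) (·μ-identityʳ a)) , ·μ-identityʳ }
        ; inverse = (λ a → trans (·μ-comm (μ⁻¹ a) a) (·μ-inverseʳ a)) , ·μ-inverseʳ
        ; ⁻¹-cong = cong μ⁻¹ }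
      ; comm = ·μ-comm } }

  μ-commutativeMonoid : CommutativeMonoid 0ℓ 0ℓ
  μ-commutativeMonoid = AbelianGroup.commutativeMonoid μ-abelianGroup

  open AbelianGroup μ-abelianGroup public using () renaming
    (identityˡ to ·μ-identityˡ; inverseˡ to ·μ-inverseˡ)
  open GroupProperties (AbelianGroup.group μ-abelianGroup) public using () renaming
    (∙-cancelˡ to ·μ-cancelˡ; ⁻¹-involutive to μ⁻¹-involutive;
     inverseˡ-unique to ≡μ⁻¹-unique)

open RootsOfUnity public

module FiniteProducts {n : ℕ} .{{_ : NonZero n}} where
  private module ∑ = SumProperties (μ-commutativeMonoid {n})

  whenμ : ∀ {p} {P : Set p} → Dec P → μ n → μ n
  whenμ r a = if does r then a else 1μ

  whenμ-resp : ∀ {p q} {P : Set p} {Q : Set q} (r : Dec P) (r′ : Dec Q) {a b : μ n} →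
               (P → Q) → (Q → P) → (P → a ≡ b) → whenμ r a ≡ whenμ r′ b
  whenμ-resp (yes p) (yes q) P⇒Q Q⇒P a≡b = a≡b p
  whenμ-resp (yes p) (no ¬q) P⇒Q Q⇒P a≡b = ⊥-elim (¬q (P⇒Q p))
  whenμ-resp (no ¬p) (yes q) P⇒Q Q⇒P a≡b = ⊥-elim (¬p (Q⇒P q))
  whenμ-resp (no ¬p) (no ¬q) P⇒Q Q⇒P a≡b = refl

  whenμ-distrib : ∀ {p} {P : Set p} (r : Dec P) (a b : μ n) →
                  whenμ r (a ·μ b) ≡ whenμ r a ·μ whenμ r b
  whenμ-distrib (yes _) a b = refl
  whenμ-distrib (no _)  a b = sym (·μ-identityˡ 1μ)

  whenμ-1 : ∀ {p} {P : Set p} (r : Dec P) → whenμ r 1μ ≡ 1μ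
  whenμ-1 (yes _) = refl
  whenμ-1 (no _)  = refl

  prodμ≡sum : ∀ k (d : Fin k → μ n) → prodμ k d ≡ ∑.sum d
  prodμ≡sum zero    d = refl
  prodμ≡sum (suc k) d = cong (d fzero ·μ_) (prodμ≡sum k (λ i → d (fsuc i)))

  prodμ-cong : ∀ k {d e : Fin k → μ n} → (∀ i → d i ≡ e i) → prodμ k d ≡ prodμ k e
  prodμ-cong zero    d≗e = refl
  prodμ-cong (suc k) d≗e = cong₂ _·μ_ (d≗e fzero) (prodμ-cong k (λ i → d≗e (fsuc i)))

  prodμ-1 : ∀ k → prodμ k (λ _ → 1μ {n}) ≡ 1μ
  prodμ-1 k = trans (prodμ≡sum k _) (∑.sum-replicate-zero k)

  prodμ-distrib : ∀ k (d e : Fin k → μ n) →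
                  prodμ k (λ i → d i ·μ e i) ≡ prodμ k d ·μ prodμ k e
  prodμ-distrib k d e = begin
    prodμ k (λ i → d i ·μ e i) ≡⟨ prodμ≡sum k _ ⟩
    ∑.sum (λ i → d i ·μ e i)   ≡⟨ ∑.∑-distrib-+ d e ⟩
    ∑.sum d ·μ ∑.sum e         ≡⟨ cong₂ _·μ_ (prodμ≡sum k d) (prodμ≡sum k e) ⟨
    prodμ k d ·μ prodμ k e     ∎
    where open ≡-Reasoning

  prodμ-reindex : ∀ {m k} (d : Fin k → μ n) (π : Fin m ↔ Fin k) →
                  prodμ k d ≡ prodμ m (λ i → d (Inverse.to π i))
  prodμ-reindex {m} {k} d π = begin
    prodμ k d                          ≡⟨ prodμ≡sum k d ⟩
    ∑.sum d                            ≡⟨ ∑.sum-permute d π ⟩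
    ∑.sum (λ i → d (Inverse.to π i))   ≡⟨ prodμ≡sum m _ ⟨
    prodμ m (λ i → d (Inverse.to π i)) ∎
    where open ≡-Reasoning

  prodμ-swap : ∀ m k (d : Fin m → Fin k → μ n) →
               prodμ m (λ i → prodμ k (d i)) ≡ prodμ k (λ j → prodμ m (λ i → d i j))
  prodμ-swap m k d = begin
    prodμ m (λ i → prodμ k (d i))         ≡⟨ prodμ-cong m (λ i → prodμ≡sum k (d i)) ⟩
    prodμ m (λ i → ∑.sum (d i))           ≡⟨ prodμ≡sum m _ ⟩
    ∑.sum (λ i → ∑.sum (d i))             ≡⟨ ∑.∑-comm d ⟩
    ∑.sum (λ j → ∑.sum (λ i → d i j))     ≡⟨ prodμ≡sum k _ ⟨
    prodμ k (λ j → ∑.sum (λ i → d i j))   ≡⟨ prodμ-cong k (λ j → prodμ≡sum m (λ i → d i j)) ⟨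
    prodμ k (λ j → prodμ m (λ i → d i j)) ∎
    where open ≡-Reasoning

  prodμ-indicator : ∀ k (i₀ : Fin k) (a : μ n) → prodμ k (λ i → whenμ (i ≟Fin i₀) a) ≡ a
  prodμ-indicator (suc k) fzero a = begin
    a ·μ prodμ k (λ i → whenμ (fsuc i ≟Fin fzero) a) ≡⟨ cong (a ·μ_) (prodμ-1 k) ⟩
    a ·μ 1μ                                          ≡⟨ ·μ-identityʳ a ⟩
    a                                                ∎
    where open ≡-Reasoning
  prodμ-indicator (suc k) (fsuc i₀) a =
    trans (·μ-identityˡ _) (prodμ-indicator k i₀ a)

  prodμ-++ : ∀ k l (d : Fin (k + l) → μ n) →
             prodμ (k + l) d ≡ prodμ k (λ i → d (i ↑ˡ l)) ·μ prodμ l (λ j → d (k ↑ʳ j))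
  prodμ-++ zero    l d = sym (·μ-identityˡ _)
  prodμ-++ (suc k) l d = trans (cong (d fzero ·μ_) (prodμ-++ k l (λ i → d (fsuc i))))
                               (sym (·μ-assoc _ _ _))

  prodμ-combine : ∀ m k (d : Fin (m * k) → μ n) →
                  prodμ (m * k) d ≡ prodμ m (λ i → prodμ k (λ j → d (combine i j)))
  prodμ-combine zero    k d = refl
  prodμ-combine (suc m) k d = trans (prodμ-++ k (m * k) d)
    (cong (prodμ k (λ j → d (j ↑ˡ (m * k))) ·μ_) (prodμ-combine m k (λ x → d (k ↑ʳ x))))

  infix 25 _^μ_
  _^μ_ : μ n → ℕ → μ n
  a ^μ k = prodμ k (λ _ → a)

  prodμ-^μ : ∀ m k (d : Fin m → μ n) → prodμ m (λ i → d i ^μ k) ≡ prodμ m d ^μ k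
  prodμ-^μ m k d = prodμ-swap m k (λ i _ → d i)

open FiniteProducts public

module FreePointedAction {n : ℕ} .{{_ : NonZero n}} (X : FinAbMuGroup n) where
  open FinAbMuGroup X

  act-inverseˡ : ∀ ζ x → act (μ⁻¹ ζ) (act ζ x) ≡ x
  act-inverseˡ ζ x = begin
    act (μ⁻¹ ζ) (act ζ x) ≡⟨ act-comp (μ⁻¹ ζ) ζ x ⟨
    act (μ⁻¹ ζ ·μ ζ) x    ≡⟨ cong (λ ξ → act ξ x) (·μ-inverseˡ ζ) ⟩
    act 1μ x              ≡⟨ act-unit x ⟩
    x                     ∎
    where open ≡-Reasoning

  act-inverseʳ : ∀ ζ x → act ζ (act (μ⁻¹ ζ) x) ≡ x
  act-inverseʳ ζ x = begin
    act ζ (act (μ⁻¹ ζ) x) ≡⟨ act-comp ζ (μ⁻¹ ζ) x ⟨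
    act (ζ ·μ μ⁻¹ ζ) x    ≡⟨ cong (λ ξ → act ξ x) (·μ-inverseʳ ζ) ⟩
    act 1μ x              ≡⟨ act-unit x ⟩
    x                     ∎
    where open ≡-Reasoning

  act-injective : ∀ ζ {x y} → act ζ x ≡ act ζ y → x ≡ y
  act-injective ζ {x} {y} eq =
    trans (sym (act-inverseˡ ζ x)) (trans (cong (act (μ⁻¹ ζ)) eq) (act-inverseˡ ζ y))

  act-≢0 : ∀ ζ {x} → x ≢ 0# → act ζ x ≢ 0#
  act-≢0 ζ x≢0 eq = x≢0 (act-injective ζ (trans eq (sym (act-pt ζ))))

  act-0 : ∀ ζ {x} → x ≡ 0# → act ζ x ≡ 0#
  act-0 ζ x≡0 = trans (cong (act ζ) x≡0) (act-pt ζ)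

  act≢0⇒≢0 : ∀ ζ {x} → act ζ x ≢ 0# → x ≢ 0#
  act≢0⇒≢0 ζ ζx≢0 x≡0 = ζx≢0 (act-0 ζ x≡0)

  act-cancelʳ : ∀ {ζ ξ x} → x ≢ 0# → act ζ x ≡ act ξ x → ζ ≡ ξ
  act-cancelʳ {ζ} {ξ} {x} x≢0 eq = ·μ-cancelˡ (μ⁻¹ ξ) ζ ξ (trans fixes (sym (·μ-inverseˡ ξ)))
    where
      fixes : μ⁻¹ ξ ·μ ζ ≡ 1μ
      fixes = act-free _ x x≢0 (begin
        act (μ⁻¹ ξ ·μ ζ) x    ≡⟨ act-comp (μ⁻¹ ξ) ζ x ⟩
        act (μ⁻¹ ξ) (act ζ x) ≡⟨ cong (act (μ⁻¹ ξ)) eq ⟩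
        act (μ⁻¹ ξ) (act ξ x) ≡⟨ act-inverseˡ ξ x ⟩
        x                     ∎)
        where open ≡-Reasoning

  toFin : Carrier → Fin size
  toFin = Inverse.to finite

  enum-toFin : ∀ x → enum (toFin x) ≡ x
  enum-toFin = Inverse.strictlyInverseʳ finite

  toFin-enum : ∀ i → toFin (enum i) ≡ i
  toFin-enum = Inverse.strictlyInverseˡ finite

  ∏ : (Carrier → μ n) → μ n
  ∏ F = prodμ size (λ i → F (enum i))

  ∏-cong : ∀ {F G} → (∀ x → F x ≡ G x) → ∏ F ≡ ∏ G
  ∏-cong F≗G = prodμ-cong size (λ i → F≗G (enum i))

  ∏-distrib : ∀ F G → ∏ (λ x → F x ·μ G x) ≡ ∏ F ·μ ∏ G
  ∏-distrib F G = prodμ-distrib size _ _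

  ∏-reindex : ∀ (φ ψ : Carrier → Carrier) → (∀ x → φ (ψ x) ≡ x) → (∀ x → ψ (φ x) ≡ x) →
              ∀ F → ∏ F ≡ ∏ (λ x → F (φ x))
  ∏-reindex φ ψ φψ ψφ F =
    trans (prodμ-reindex (λ i → F (enum i)) π) (prodμ-cong size (λ i → cong F (enum-toFin _)))
    where
      π : Fin size ↔ Fin size
      π = mk↔ₛ′ (λ i → toFin (φ (enum i))) (λ j → toFin (ψ (enum j)))
            (λ j → trans (cong (λ x → toFin (φ x)) (enum-toFin _)) (trans (cong toFin (φψ _)) (toFin-enum j)))
            (λ j → trans (cong (λ x → toFin (ψ x)) (enum-toFin _)) (trans (cong toFin (ψφ _)) (toFin-enum j)))

  ∏-indicator : ∀ x₀ a → ∏ (λ x → whenμ (x ≟ x₀) a) ≡ a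
  ∏-indicator x₀ a = trans (prodμ-cong size same-index) (prodμ-indicator size (toFin x₀) a)
    where
      same-index : ∀ i → whenμ (enum i ≟ x₀) a ≡ whenμ (i ≟Fin toFin x₀) a
      same-index i = whenμ-resp (enum i ≟ x₀) (i ≟Fin toFin x₀)
        (λ eq → trans (sym (toFin-enum i)) (cong toFin eq))
        (λ eq → trans (cong enum eq) (enum-toFin x₀))
        (λ _ → refl)

  exponent : Section X → Carrier → μ n
  exponent s x = proj₁ (sec-orbit s x)

  exponent-spec : ∀ s x → sec s x ≡ act (exponent s x) x
  exponent-spec s x = proj₂ (sec-orbit s x)

  sec-≢0 : ∀ s {x} → x ≢ 0# → sec s x ≢ 0#
  sec-≢0 s {x} x≢0 eq = act-≢0 (exponent s x) x≢0 (trans (sym (exponent-spec s x)) eq)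

  transition : Section X → Section X → Carrier → μ n
  transition s s′ x = exponent s′ x ·μ μ⁻¹ (exponent s x)

  transition-spec : ∀ s s′ x → sec s′ x ≡ act (transition s s′ x) (sec s x)
  transition-spec s s′ x = begin
    sec s′ x                                       ≡⟨ exponent-spec s′ x ⟩
    act (exponent s′ x) x                          ≡⟨ cong (λ ξ → act ξ x) exponents ⟨
    act (transition s s′ x ·μ exponent s x) x      ≡⟨ act-comp _ _ x ⟩
    act (transition s s′ x) (act (exponent s x) x) ≡⟨ cong (act _) (exponent-spec s x) ⟨
    act (transition s s′ x) (sec s x)              ∎
    where
      open ≡-Reasoning
      exponents : transition s s′ x ·μ exponent s x ≡ exponent s′ x
      exponents = trans (·μ-assoc _ _ _)
        (trans (cong (exponent s′ x ·μ_) (·μ-inverseˡ _)) (·μ-identityʳ _))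

  transition-unique : ∀ s s′ (d : Carrier → μ n) → (∀ x → sec s′ x ≡ act (d x) (sec s x)) →
                      ∀ x → x ≢ 0# → d x ≡ transition s s′ x
  transition-unique s s′ d d-spec x x≢0 =
    act-cancelʳ (sec-≢0 s x≢0) (trans (sym (d-spec x)) (transition-spec s s′ x))

  OrbitInvariant : (Carrier → μ n) → Set
  OrbitInvariant d = ∀ ξ x → x ≢ 0# → d (act ξ x) ≡ d x

  transition-orbitInvariant : ∀ s s′ → OrbitInvariant (transition s s′)
  transition-orbitInvariant s s′ ξ x x≢0 =
    transition-unique s s′ (λ y → transition s s′ (act ξ y)) moved x x≢0
    where
      moved : ∀ y → sec s′ y ≡ act (transition s s′ (act ξ y)) (sec s y)
      moved y = begin
        sec s′ y                                          ≡⟨ sec-const s′ ξ y ⟨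
        sec s′ (act ξ y)                                  ≡⟨ transition-spec s s′ (act ξ y) ⟩
        act (transition s s′ (act ξ y)) (sec s (act ξ y)) ≡⟨ cong (act _) (sec-const s ξ y) ⟩
        act (transition s s′ (act ξ y)) (sec s y)         ∎
        where open ≡-Reasoning

  IsRep : Section X → Carrier → Set
  IsRep s x = (x ≢ 0#) × (sec s x ≡ x)

  weight : Section X → (Carrier → μ n) → Carrier → μ n
  weight s d x = whenμ (isRep? X s x) (d x)

  weight-0 : ∀ s d → weight s d 0# ≡ 1μ
  weight-0 s d with isRep? X s 0#
  ... | yes (0≢0 , _) = ⊥-elim (0≢0 refl)
  ... | no _          = refl

  -- prodOverOrbits multiplies a function local to its where-block; factorsOf recovers
  -- that function by unification, so that it can be compared with weight.
  private
    factorsOf : ∀ {k} {a : μ n} {F : Fin k → μ n} → prodμ k F ≡ a → Fin k → μ n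
    factorsOf {F = F} _ = F

  prodOverOrbits≡∏weight : ∀ s d → prodOverOrbits X s d ≡ ∏ (weight s d)
  prodOverOrbits≡∏weight s d = prodμ-cong size factor≡weight
    where
      factor≡weight : ∀ i → factorsOf (refl {x = prodOverOrbits X s d}) i ≡ weight s d (enum i)
      factor≡weight i with isRep? X s (enum i)
      ... | yes _ = refl
      ... | no _  = refl

  prodOverOrbits-cong : ∀ s {d d′} → (∀ x → x ≢ 0# → d x ≡ d′ x) →
                        prodOverOrbits X s d ≡ prodOverOrbits X s d′
  prodOverOrbits-cong s {d} {d′} d≗d′ = begin
    prodOverOrbits X s d  ≡⟨ prodOverOrbits≡∏weight s d ⟩
    ∏ (weight s d)        ≡⟨ ∏-cong (λ x → whenμ-resp (isRep? X s x) (isRep? X s x)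
                                                (λ r → r) (λ r → r) (λ r → d≗d′ x (proj₁ r))) ⟩
    ∏ (weight s d′)       ≡⟨ prodOverOrbits≡∏weight s d′ ⟨
    prodOverOrbits X s d′ ∎
    where open ≡-Reasoning

  prodOverOrbits-distrib : ∀ s d e → prodOverOrbits X s (λ x → d x ·μ e x) ≡
                                     prodOverOrbits X s d ·μ prodOverOrbits X s e
  prodOverOrbits-distrib s d e = begin
    prodOverOrbits X s (λ x → d x ·μ e x)        ≡⟨ prodOverOrbits≡∏weight s _ ⟩
    ∏ (weight s (λ x → d x ·μ e x))              ≡⟨ ∏-cong (λ x → whenμ-distrib (isRep? X s x) (d x) (e x)) ⟩
    ∏ (λ x → weight s d x ·μ weight s e x)       ≡⟨ ∏-distrib (weight s d) (weight s e) ⟩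
    ∏ (weight s d) ·μ ∏ (weight s e)
      ≡⟨ cong₂ _·μ_ (prodOverOrbits≡∏weight s d) (prodOverOrbits≡∏weight s e) ⟨
    prodOverOrbits X s d ·μ prodOverOrbits X s e ∎
    where open ≡-Reasoning

  prodOverOrbits-1 : ∀ s → prodOverOrbits X s (λ _ → 1μ) ≡ 1μ
  prodOverOrbits-1 s = trans (prodOverOrbits≡∏weight s _)
    (trans (∏-cong (λ x → whenμ-1 (isRep? X s x))) (prodμ-1 size))

  twist : (Carrier → μ n) → Carrier → Carrier
  twist d x = act (d x) x

  twist-twist : ∀ {d e} → OrbitInvariant e → (∀ x → e x ·μ d x ≡ 1μ) →
                ∀ x → twist e (twist d x) ≡ x
  twist-twist {d} {e} e-inv ed≡1 x with x ≟ 0#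
  ... | yes x≡0 = trans (act-0 _ (act-0 (d x) x≡0)) (sym x≡0)
  ... | no x≢0 = begin
    act (e (act (d x) x)) (act (d x) x) ≡⟨ cong (λ ξ → act ξ (act (d x) x)) (e-inv (d x) x x≢0) ⟩
    act (e x) (act (d x) x)             ≡⟨ act-comp (e x) (d x) x ⟨
    act (e x ·μ d x) x                  ≡⟨ cong (λ ξ → act ξ x) (ed≡1 x) ⟩
    act 1μ x                            ≡⟨ act-unit x ⟩
    x                                   ∎
    where open ≡-Reasoning

  -- x ↦ transition s s′ x · x permutes X and carries the representatives of s to those of s′.
  prodOverOrbits-sectionIndependent : ∀ s s′ {d} → OrbitInvariant d →
                                      prodOverOrbits X s d ≡ prodOverOrbits X s′ d
  prodOverOrbits-sectionIndependent s s′ {d} d-inv = begin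
    prodOverOrbits X s d  ≡⟨ prodOverOrbits≡∏weight s d ⟩
    ∏ (weight s d)        ≡⟨ ∏-cong moved ⟩
    ∏ (λ x → weight s′ d (twist r x))
      ≡⟨ ∏-reindex (twist r) (twist r⁻¹) twist-untwist untwist-twist (weight s′ d) ⟨
    ∏ (weight s′ d)       ≡⟨ prodOverOrbits≡∏weight s′ d ⟨
    prodOverOrbits X s′ d ∎
    where
      open ≡-Reasoning
      r = transition s s′
      r⁻¹ = λ x → μ⁻¹ (r x)
      r-inv : OrbitInvariant r
      r-inv = transition-orbitInvariant s s′
      twist-untwist : ∀ x → twist r (twist r⁻¹ x) ≡ x
      twist-untwist = twist-twist r-inv (λ x → ·μ-inverseʳ (r x))
      untwist-twist : ∀ x → twist r⁻¹ (twist r x) ≡ x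
      untwist-twist = twist-twist (λ ξ x x≢0 → cong μ⁻¹ (r-inv ξ x x≢0)) (λ x → ·μ-inverseˡ (r x))
      rep⇒rep : ∀ x → IsRep s x → IsRep s′ (twist r x)
      rep⇒rep x (x≢0 , sx≡x) = act-≢0 (r x) x≢0 ,
        trans (sec-const s′ (r x) x) (trans (transition-spec s s′ x) (cong (act (r x)) sx≡x))
      rep⇐rep : ∀ x → IsRep s′ (twist r x) → IsRep s x
      rep⇐rep x (rx≢0 , s′rx≡rx) = act≢0⇒≢0 (r x) rx≢0 ,
        act-injective (r x) (trans (sym (transition-spec s s′ x)) (trans (sym (sec-const s′ (r x) x)) s′rx≡rx))
      moved : ∀ x → weight s d x ≡ weight s′ d (twist r x)
      moved x = whenμ-resp (isRep? X s x) (isRep? X s′ (twist r x)) (rep⇒rep x) (rep⇐rep x)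
        (λ rep → sym (d-inv (r x) x (proj₁ rep)))

  δ : Section X → Section X → μ n
  δ s s′ = prodOverOrbits X s (transition s s′)

  ≈Line⇒≡·δ : ∀ ζ s ζ′ s′ → _≈Line_ X (ζ , s) (ζ′ , s′) → ζ ≡ ζ′ ·μ δ s s′
  ≈Line⇒≡·δ ζ s ζ′ s′ (d , d-spec , ζ≡ζ′·∏d) =
    trans ζ≡ζ′·∏d (cong (_ ·μ_) (prodOverOrbits-cong s (transition-unique s s′ d d-spec)))

  ≡·δ⇒≈Line : ∀ ζ s ζ′ s′ → ζ ≡ ζ′ ·μ δ s s′ → _≈Line_ X (ζ , s) (ζ′ , s′)
  ≡·δ⇒≈Line ζ s ζ′ s′ eq = transition s s′ , transition-spec s s′ , eq

  δ-pointwise : ∀ s s′ → (∀ x → sec s x ≡ sec s′ x) → δ s s′ ≡ 1μ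
  δ-pointwise s s′ s≗s′ = trans (prodOverOrbits-cong s trivial) (prodOverOrbits-1 s)
    where
      trivial : ∀ x → x ≢ 0# → transition s s′ x ≡ 1μ
      trivial x x≢0 = sym (transition-unique s s′ (λ _ → 1μ)
        (λ y → trans (sym (s≗s′ y)) (sym (act-unit _))) x x≢0)

  δ-refl : ∀ s → δ s s ≡ 1μ
  δ-refl s = δ-pointwise s s (λ _ → refl)

  δ-trans : ∀ s s′ s″ → δ s s″ ≡ δ s s′ ·μ δ s′ s″
  δ-trans s s′ s″ = begin
    δ s s″                                                             ≡⟨ prodOverOrbits-cong s composite ⟩
    prodOverOrbits X s (λ x → transition s s′ x ·μ transition s′ s″ x) ≡⟨ prodOverOrbits-distrib s _ _ ⟩
    δ s s′ ·μ prodOverOrbits X s (transition s′ s″)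
      ≡⟨ cong (δ s s′ ·μ_) (prodOverOrbits-sectionIndependent s s′ (transition-orbitInvariant s′ s″)) ⟩
    δ s s′ ·μ δ s′ s″                                                  ∎
    where
      open ≡-Reasoning
      step : ∀ x → sec s″ x ≡ act (transition s s′ x ·μ transition s′ s″ x) (sec s x)
      step x = begin
        sec s″ x                                                     ≡⟨ transition-spec s′ s″ x ⟩
        act (transition s′ s″ x) (sec s′ x)                          ≡⟨ cong (act _) (transition-spec s s′ x) ⟩
        act (transition s′ s″ x) (act (transition s s′ x) (sec s x)) ≡⟨ act-comp _ _ _ ⟨
        act (transition s′ s″ x ·μ transition s s′ x) (sec s x)
          ≡⟨ cong (λ ξ → act ξ (sec s x)) (·μ-comm (transition s′ s″ x) (transition s s′ x)) ⟩
        act (transition s s′ x ·μ transition s′ s″ x) (sec s x)      ∎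
      composite : ∀ x → x ≢ 0# → transition s s″ x ≡ transition s s′ x ·μ transition s′ s″ x
      composite x x≢0 = sym (transition-unique s s″ _ step x x≢0)

  δ-sym : ∀ s s′ → δ s′ s ·μ δ s s′ ≡ 1μ
  δ-sym s s′ = trans (sym (δ-trans s′ s s′)) (δ-refl s′)

  -- Each orbit is represented by its element of least index in the enumeration of X.
  someSection : Section X
  someSection = record
    { sec       = λ x → act (minimiser x) x
    ; sec-orbit = λ x → minimiser x , refl
    ; sec-const = λ ξ x → toFin-injective (toℕ-injective (≤-antisym (shifted ξ x) (unshifted ξ x)))
    }
    where
      key : Carrier → ℕ
      key x = toℕ (toFin x)
      minimiser : Carrier → μ n
      minimiser x = argmin (λ ζ → key (act ζ x)) 1μ (allFin n)
      minimal : ∀ x ζ → key (act (minimiser x) x) ≤ key (act ζ x)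
      minimal x ζ = All.lookup (f[argmin]≤f[xs] 1μ (allFin n)) (∈-allFin ζ)
      toFin-injective : ∀ {x y} → toFin x ≡ toFin y → x ≡ y
      toFin-injective {x} {y} eq = trans (sym (enum-toFin x)) (trans (cong enum eq) (enum-toFin y))
      shifted : ∀ ξ x → key (act (minimiser (act ξ x)) (act ξ x)) ≤ key (act (minimiser x) x)
      shifted ξ x = subst (λ y → key (act (minimiser (act ξ x)) (act ξ x)) ≤ key y)
        (trans (act-comp _ _ _) (cong (act (minimiser x)) (act-inverseˡ ξ x)))
        (minimal (act ξ x) (minimiser x ·μ μ⁻¹ ξ))
      unshifted : ∀ ξ x → key (act (minimiser x) x) ≤ key (act (minimiser (act ξ x)) (act ξ x))
      unshifted ξ x = subst (λ y → key (act (minimiser x) x) ≤ key y) (act-comp _ _ _)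
        (minimal x (minimiser (act ξ x) ·μ ξ))

  exponent-shift : ∀ s ξ {x} → x ≢ 0# → exponent s (act ξ x) ·μ ξ ≡ exponent s x
  exponent-shift s ξ {x} x≢0 = act-cancelʳ x≢0 (begin
    act (exponent s (act ξ x) ·μ ξ) x    ≡⟨ act-comp _ ξ x ⟩
    act (exponent s (act ξ x)) (act ξ x) ≡⟨ exponent-spec s (act ξ x) ⟨
    sec s (act ξ x)                      ≡⟨ sec-const s ξ x ⟩
    sec s x                              ≡⟨ exponent-spec s x ⟩
    act (exponent s x) x                 ∎)
    where open ≡-Reasoning

  -- |X| ≡ 1 (mod n). Off 0, acting by ξ = a⁻¹ multiplies the exponents F of a section by a,
  -- so comparing ∏ F with its reindexing by ξ gives a ^μ |X| · a⁻¹ = 1.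
  ^μ-size : ∀ a → a ^μ size ≡ a
  ^μ-size a = trans (≡μ⁻¹-unique (a ^μ size) ξ ∏correction≡1) (μ⁻¹-involutive a)
    where
      ξ = μ⁻¹ a
      F = exponent someSection
      correction : Carrier → μ n
      correction x = a ·μ whenμ (x ≟ 0#) ξ
      shift : ∀ x (x≟0 : Dec (x ≡ 0#)) → F (act ξ x) ≡ F x ·μ (a ·μ whenμ x≟0 ξ)
      shift x (yes x≡0) = begin
        F (act ξ x)     ≡⟨ cong F (trans (act-0 ξ x≡0) (sym x≡0)) ⟩
        F x             ≡⟨ ·μ-identityʳ (F x) ⟨
        F x ·μ 1μ       ≡⟨ cong (F x ·μ_) (·μ-inverseʳ a) ⟨
        F x ·μ (a ·μ ξ) ∎
        where open ≡-Reasoning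
      shift x (no x≢0) = begin
        F (act ξ x)             ≡⟨ ·μ-identityʳ _ ⟨
        F (act ξ x) ·μ 1μ       ≡⟨ cong (F (act ξ x) ·μ_) (·μ-inverseˡ a) ⟨
        F (act ξ x) ·μ (ξ ·μ a) ≡⟨ ·μ-assoc _ ξ a ⟨
        (F (act ξ x) ·μ ξ) ·μ a ≡⟨ cong (_·μ a) (exponent-shift someSection ξ x≢0) ⟩
        F x ·μ a                ≡⟨ cong (F x ·μ_) (·μ-identityʳ a) ⟨
        F x ·μ (a ·μ 1μ)        ∎
        where open ≡-Reasoning
      ∏correction≡1 : a ^μ size ·μ ξ ≡ 1μ
      ∏correction≡1 = ·μ-cancelˡ (∏ F) _ _ (begin
        ∏ F ·μ (a ^μ size ·μ ξ)       ≡⟨ cong (λ v → ∏ F ·μ (a ^μ size ·μ v)) (∏-indicator 0# ξ) ⟨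
        ∏ F ·μ (a ^μ size ·μ ∏ (λ x → whenμ (x ≟ 0#) ξ))
          ≡⟨ cong (∏ F ·μ_) (∏-distrib (λ _ → a) (λ x → whenμ (x ≟ 0#) ξ)) ⟨
        ∏ F ·μ ∏ correction           ≡⟨ ∏-distrib F correction ⟨
        ∏ (λ x → F x ·μ correction x) ≡⟨ ∏-cong (λ x → shift x (x ≟ 0#)) ⟨
        ∏ (λ x → F (act ξ x))         ≡⟨ ∏-reindex (act ξ) (act (μ⁻¹ ξ)) (act-inverseʳ ξ) (act-inverseˡ ξ) F ⟨
        ∏ F                           ≡⟨ ·μ-identityʳ (∏ F) ⟨
        ∏ F ·μ 1μ                     ∎)
        where open ≡-Reasoning

module AdditiveGroups {n : ℕ} .{{_ : NonZero n}} where

  additiveGroup : FinAbMuGroup n → Group 0ℓ 0ℓ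
  additiveGroup A = record { isGroup = IsAbelianGroup.isGroup (FinAbMuGroup.isAbelianGroup A) }

  module _ (A B : FinAbMuGroup n) where
    private
      module A = FinAbMuGroup A
      module B = FinAbMuGroup B

    +-homo⇒0-homo : (h : A.Carrier → B.Carrier) → (∀ a a′ → h (a A.+ a′) ≡ h a B.+ h a′) →
                    h A.0# ≡ B.0#
    +-homo⇒0-homo h h-hom = GroupProperties.∙-cancelˡ (additiveGroup B) (h A.0#) _ _ (begin
      h A.0# B.+ h A.0# ≡⟨ h-hom A.0# A.0# ⟨
      h (A.0# A.+ A.0#) ≡⟨ cong h (Group.identityˡ (additiveGroup A) A.0#) ⟩
      h A.0#            ≡⟨ Group.identityʳ (additiveGroup B) (h A.0#) ⟨
      h A.0# B.+ B.0#   ∎)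
      where open ≡-Reasoning

    +-homo⇒⁻¹-homo : (h : A.Carrier → B.Carrier) → (∀ a a′ → h (a A.+ a′) ≡ h a B.+ h a′) →
                     ∀ a → h (A.- a) ≡ B.- (h a)
    +-homo⇒⁻¹-homo h h-hom a = GroupProperties.inverseʳ-unique (additiveGroup B) (h a) (h (A.- a)) (begin
      h a B.+ h (A.- a) ≡⟨ h-hom a (A.- a) ⟨
      h (a A.+ (A.- a)) ≡⟨ cong h (Group.inverseʳ (additiveGroup A) a) ⟩
      h A.0#            ≡⟨ +-homo⇒0-homo h h-hom ⟩
      B.0#              ∎)
      where open ≡-Reasoning

open AdditiveGroups public

module ShortExact {n : ℕ} .{{_ : NonZero n}} (E : SES n) where
  open SES E public
  module X = FinAbMuGroup X
  module Y = FinAbMuGroup Y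
  module Z = FinAbMuGroup Z
  module AX = FreePointedAction X
  module AY = FreePointedAction Y
  module AZ = FreePointedAction Z
  private
    module +Y = GroupProperties (additiveGroup Y)

  f-0 : f X.0# ≡ Y.0#
  f-0 = +-homo⇒0-homo X Y f f-hom

  g-0 : g Y.0# ≡ Z.0#
  g-0 = +-homo⇒0-homo Y Z g g-hom

  f-≢0 : ∀ {x} → x ≢ X.0# → f x ≢ Y.0#
  f-≢0 x≢0 fx≡0 = x≢0 (f-inj _ _ (trans fx≡0 (sym f-0)))

  f≢0⇒≢0 : ∀ {x} → f x ≢ Y.0# → x ≢ X.0#
  f≢0⇒≢0 fx≢0 x≡0 = fx≢0 (trans (cong f x≡0) f-0)

  g≢0⇒≢0 : ∀ {y} → g y ≢ Z.0# → y ≢ Y.0#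
  g≢0⇒≢0 gy≢0 y≡0 = gy≢0 (trans (cong g y≡0) g-0)

  g-act : ∀ ζ {y} → g y ≡ Z.0# → g (Y.act ζ y) ≡ Z.0#
  g-act ζ {y} gy≡0 = trans (g-equiv ζ y) (AZ.act-0 ζ gy≡0)

  g-act⁻¹ : ∀ ζ {y} → g (Y.act ζ y) ≡ Z.0# → g y ≡ Z.0#
  g-act⁻¹ ζ {y} gζy≡0 = AZ.act-injective ζ (trans (sym (g-equiv ζ y)) (trans gζy≡0 (sym (Z.act-pt ζ))))

  preimage : (y : Y.Carrier) → g y ≡ Z.0# → X.Carrier
  preimage y gy≡0 = proj₁ (ker⊆im y gy≡0)

  f-preimage : ∀ y gy≡0 → f (preimage y gy≡0) ≡ y
  f-preimage y gy≡0 = proj₂ (ker⊆im y gy≡0)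

  preimage-f : ∀ x gfx≡0 → preimage (f x) gfx≡0 ≡ x
  preimage-f x gfx≡0 = f-inj _ _ (f-preimage (f x) gfx≡0)

  act-cancel-over : ∀ {ζ ξ} y → g y ≢ Z.0# → Z.act ζ (g y) ≡ Z.act ξ (g y) → Y.act ζ y ≡ Y.act ξ y
  act-cancel-over y gy≢0 eq = cong (λ ζ → Y.act ζ y) (AZ.act-cancelʳ gy≢0 eq)

  lift : Z.Carrier → Y.Carrier
  lift z with z Z.≟ Z.0#
  ... | yes _ = Y.0#
  ... | no _  = proj₁ (g-surj z)

  g-lift : ∀ z → g (lift z) ≡ z
  g-lift z with z Z.≟ Z.0#
  ... | yes z≡0 = trans g-0 (sym z≡0)
  ... | no _    = proj₂ (g-surj z)

  lift-0 : lift Z.0# ≡ Y.0#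
  lift-0 with Z.0# Z.≟ Z.0#
  ... | yes _  = refl
  ... | no 0≢0 = ⊥-elim (0≢0 refl)

  glued : Section X → Section Z → (y : Y.Carrier) → Dec (g y ≡ Z.0#) → Y.Carrier
  glued s t y (yes gy≡0) = f (sec s (preimage y gy≡0))
  glued s t y (no _)     = Y.act (AZ.exponent t (g y)) y

  glued-orbit : ∀ s t y r → ∃ λ ζ → glued s t y r ≡ Y.act ζ y
  glued-orbit s t y (yes gy≡0) = AX.exponent s x , (begin
    f (sec s x)                   ≡⟨ cong f (AX.exponent-spec s x) ⟩
    f (X.act (AX.exponent s x) x) ≡⟨ f-equiv _ x ⟩
    Y.act (AX.exponent s x) (f x) ≡⟨ cong (Y.act _) (f-preimage y gy≡0) ⟩
    Y.act (AX.exponent s x) y     ∎)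
    where
      open ≡-Reasoning
      x = preimage y gy≡0
  glued-orbit s t y (no _) = AZ.exponent t (g y) , refl

  glued-const : ∀ s t ξ y r r′ → glued s t (Y.act ξ y) r ≡ glued s t y r′
  glued-const s t ξ y (yes gξy≡0) (yes gy≡0) =
    cong f (trans (cong (sec s) preimage-act) (sec-const s ξ _))
    where
      preimage-act : preimage (Y.act ξ y) gξy≡0 ≡ X.act ξ (preimage y gy≡0)
      preimage-act = f-inj _ _ (trans (f-preimage _ gξy≡0)
        (trans (cong (Y.act ξ) (sym (f-preimage y gy≡0))) (sym (f-equiv ξ _))))
  glued-const s t ξ y (yes gξy≡0) (no gy≢0)  = ⊥-elim (gy≢0 (g-act⁻¹ ξ gξy≡0))
  glued-const s t ξ y (no gξy≢0)  (yes gy≡0) = ⊥-elim (gξy≢0 (g-act ξ gy≡0))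
  glued-const s t ξ y (no gξy≢0)  (no gy≢0)  =
    trans (sym (Y.act-comp _ _ y)) (act-cancel-over y gy≢0 (begin
      Z.act (AZ.exponent t (g (Y.act ξ y)) ·μ ξ) (g y)      ≡⟨ Z.act-comp _ ξ _ ⟩
      Z.act (AZ.exponent t (g (Y.act ξ y))) (Z.act ξ (g y)) ≡⟨ cong (Z.act _) (g-equiv ξ y) ⟨
      Z.act (AZ.exponent t (g (Y.act ξ y))) (g (Y.act ξ y)) ≡⟨ AZ.exponent-spec t _ ⟨
      sec t (g (Y.act ξ y))                                 ≡⟨ cong (sec t) (g-equiv ξ y) ⟩
      sec t (Z.act ξ (g y))                                 ≡⟨ sec-const t ξ (g y) ⟩
      sec t (g y)                                           ≡⟨ AZ.exponent-spec t (g y) ⟩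
      Z.act (AZ.exponent t (g y)) (g y)                     ∎))
    where open ≡-Reasoning

  glue : Section X → Section Z → Section Y
  glue s t = record
    { sec       = λ y → glued s t y (g y Z.≟ Z.0#)
    ; sec-orbit = λ y → glued-orbit s t y (g y Z.≟ Z.0#)
    ; sec-const = λ ξ y → glued-const s t ξ y (g (Y.act ξ y) Z.≟ Z.0#) (g y Z.≟ Z.0#)
    }

  glue-f : ∀ s t x → sec (glue s t) (f x) ≡ f (sec s x)
  glue-f s t x with g (f x) Z.≟ Z.0#
  ... | yes gfx≡0 = cong (λ x′ → f (sec s x′)) (preimage-f x gfx≡0)
  ... | no gfx≢0  = ⊥-elim (gfx≢0 (im⊆ker x))

  glue-off-kernel : ∀ s t y → g y ≢ Z.0# → sec (glue s t) y ≡ Y.act (AZ.exponent t (g y)) y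
  glue-off-kernel s t y gy≢0 with g y Z.≟ Z.0#
  ... | yes gy≡0 = ⊥-elim (gy≢0 gy≡0)
  ... | no _     = refl

  restrict : Section Y → Section X
  restrict u = record
    { sec       = λ x → preimage (sec u (f x)) (g-sec-f x)
    ; sec-orbit = λ x → AY.exponent u (f x) , f-inj _ _ (begin
        f (preimage (sec u (f x)) (g-sec-f x)) ≡⟨ f-preimage _ _ ⟩
        sec u (f x)                            ≡⟨ AY.exponent-spec u (f x) ⟩
        Y.act (AY.exponent u (f x)) (f x)      ≡⟨ f-equiv _ x ⟨
        f (X.act (AY.exponent u (f x)) x)      ∎)
    ; sec-const = λ ξ x → f-inj _ _ (begin
        f (preimage (sec u (f (X.act ξ x))) (g-sec-f (X.act ξ x))) ≡⟨ f-preimage _ _ ⟩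
        sec u (f (X.act ξ x))                                      ≡⟨ cong (sec u) (f-equiv ξ x) ⟩
        sec u (Y.act ξ (f x))                                      ≡⟨ sec-const u ξ (f x) ⟩
        sec u (f x)                                                ≡⟨ f-preimage _ _ ⟨
        f (preimage (sec u (f x)) (g-sec-f x))                     ∎)
    }
    where
      open ≡-Reasoning
      g-sec-f : ∀ x → g (sec u (f x)) ≡ Z.0#
      g-sec-f x = trans (cong g (AY.exponent-spec u (f x))) (g-act _ (im⊆ker x))

  restrict-glue : ∀ s t x → sec (restrict (glue s t)) x ≡ sec s x
  restrict-glue s t x = f-inj _ _ (trans (f-preimage _ _) (glue-f s t x))

  assemble : Z.Carrier → X.Carrier → Y.Carrier
  assemble z x = f x Y.+ lift z

  g-assemble : ∀ z x → g (assemble z x) ≡ z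
  g-assemble z x = begin
    g (f x Y.+ lift z)     ≡⟨ g-hom (f x) (lift z) ⟩
    g (f x) Z.+ g (lift z) ≡⟨ cong₂ Z._+_ (im⊆ker x) (g-lift z) ⟩
    Z.0# Z.+ z             ≡⟨ Group.identityˡ (additiveGroup Z) z ⟩
    z                      ∎
    where open ≡-Reasoning

  g-minus-lift : ∀ y → g (y Y.+ (Y.- lift (g y))) ≡ Z.0#
  g-minus-lift y = begin
    g (y Y.+ (Y.- lift (g y)))   ≡⟨ g-hom y _ ⟩
    g y Z.+ g (Y.- lift (g y))   ≡⟨ cong (g y Z.+_) (+-homo⇒⁻¹-homo Y Z g g-hom _) ⟩
    g y Z.+ (Z.- g (lift (g y))) ≡⟨ cong (λ z → g y Z.+ (Z.- z)) (g-lift (g y)) ⟩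
    g y Z.+ (Z.- g y)            ≡⟨ Group.inverseʳ (additiveGroup Z) (g y) ⟩
    Z.0#                         ∎
    where open ≡-Reasoning

  fibreCoordinate : Y.Carrier → X.Carrier
  fibreCoordinate y = preimage (y Y.+ (Y.- lift (g y))) (g-minus-lift y)

  fibreCoordinate-assemble : ∀ z x → fibreCoordinate (assemble z x) ≡ x
  fibreCoordinate-assemble z x = f-inj _ _ (begin
    f (fibreCoordinate (assemble z x)) ≡⟨ f-preimage _ _ ⟩
    assemble z x Y.+ (Y.- lift (g (assemble z x)))
      ≡⟨ cong (λ z′ → assemble z x Y.+ (Y.- lift z′)) (g-assemble z x) ⟩
    (f x Y.+ lift z) Y.+ (Y.- lift z)  ≡⟨ +Y.//-rightDividesʳ (lift z) (f x) ⟩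
    f x                                ∎)
    where open ≡-Reasoning

  assemble-coordinates : ∀ y → assemble (g y) (fibreCoordinate y) ≡ y
  assemble-coordinates y = begin
    f (fibreCoordinate y) Y.+ lift (g y)    ≡⟨ cong (Y._+ lift (g y)) (f-preimage _ _) ⟩
    (y Y.+ (Y.- lift (g y))) Y.+ lift (g y) ≡⟨ +Y.//-rightDividesˡ (lift (g y)) y ⟩
    y                                       ∎
    where open ≡-Reasoning

  ∏Y-decompose : ∀ H → AY.∏ H ≡ AZ.∏ (λ z → AX.∏ (λ x → H (assemble z x)))
  ∏Y-decompose H = begin
    AY.∏ H
      ≡⟨ prodμ-reindex (λ j → H (Y.enum j)) π ⟩
    prodμ (Z.size * X.size) (λ k → H (Y.enum (Inverse.to π k)))
      ≡⟨ prodμ-combine Z.size X.size _ ⟩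
    prodμ Z.size (λ i → prodμ X.size (λ j → H (Y.enum (Inverse.to π (combine i j)))))
      ≡⟨ prodμ-cong Z.size (λ i → prodμ-cong X.size (λ j → cong H (to-combine i j))) ⟩
    AZ.∏ (λ z → AX.∏ (λ x → H (assemble z x)))
      ∎
    where
      open ≡-Reasoning
      assembleAt : Fin Z.size → Fin X.size → Y.Carrier
      assembleAt i j = assemble (Z.enum i) (X.enum j)
      toIndex : Fin (Z.size * X.size) → Fin Y.size
      toIndex k = AY.toFin (uncurry assembleAt (remQuot {Z.size} X.size k))
      fromIndex : Fin Y.size → Fin (Z.size * X.size)
      fromIndex j = combine (AZ.toFin (g (Y.enum j))) (AX.toFin (fibreCoordinate (Y.enum j)))
      toIndex-combine : ∀ i j → toIndex (combine i j) ≡ AY.toFin (assemble (Z.enum i) (X.enum j))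
      toIndex-combine i j = cong (λ ij → AY.toFin (uncurry assembleAt ij)) (remQuot-combine i j)
      toIndex-fromIndex : ∀ j → toIndex (fromIndex j) ≡ j
      toIndex-fromIndex j = begin
        toIndex (fromIndex j)                         ≡⟨ toIndex-combine _ _ ⟩
        AY.toFin (assemble (Z.enum (AZ.toFin (g y))) (X.enum (AX.toFin (fibreCoordinate y))))
          ≡⟨ cong AY.toFin (cong₂ assemble (AZ.enum-toFin _) (AX.enum-toFin _)) ⟩
        AY.toFin (assemble (g y) (fibreCoordinate y)) ≡⟨ cong AY.toFin (assemble-coordinates y) ⟩
        AY.toFin (Y.enum j)                           ≡⟨ AY.toFin-enum j ⟩
        j                                             ∎
        where y = Y.enum j
      fromIndex-toIndex : ∀ k → fromIndex (toIndex k) ≡ k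
      fromIndex-toIndex k = begin
        fromIndex (toIndex k)
          ≡⟨ cong₂ combine (cong AZ.toFin (trans (cong g enum-y) (g-assemble _ _)))
                           (cong AX.toFin (trans (cong fibreCoordinate enum-y) (fibreCoordinate-assemble _ _))) ⟩
        combine (AZ.toFin (Z.enum i)) (AX.toFin (X.enum j)) ≡⟨ cong₂ combine (AZ.toFin-enum i) (AX.toFin-enum j) ⟩
        combine i j                                         ≡⟨ combine-remQuot {Z.size} X.size k ⟩
        k                                                   ∎
        where
          i = proj₁ (remQuot {Z.size} X.size k)
          j = proj₂ (remQuot {Z.size} X.size k)
          enum-y : Y.enum (toIndex k) ≡ assemble (Z.enum i) (X.enum j)
          enum-y = AY.enum-toFin _
      π : Fin (Z.size * X.size) ↔ Fin Y.size
      π = mk↔ₛ′ toIndex fromIndex toIndex-fromIndex fromIndex-toIndex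
      to-combine : ∀ i j → Y.enum (Inverse.to π (combine i j)) ≡ assemble (Z.enum i) (X.enum j)
      to-combine i j = trans (cong Y.enum (toIndex-combine i j)) (AY.enum-toFin _)

  assemble-0 : ∀ x → assemble Z.0# x ≡ f x
  assemble-0 x = trans (cong (f x Y.+_) lift-0) (Group.identityʳ (additiveGroup Y) (f x))

  glueμAt : (X.Carrier → μ n) → (Z.Carrier → μ n) → (y : Y.Carrier) → Dec (g y ≡ Z.0#) → μ n
  glueμAt dX dZ y (yes gy≡0) = dX (preimage y gy≡0)
  glueμAt dX dZ y (no _)     = dZ (g y)

  glueμ : (X.Carrier → μ n) → (Z.Carrier → μ n) → Y.Carrier → μ n
  glueμ dX dZ y = glueμAt dX dZ y (g y Z.≟ Z.0#)

  glueμ-f : ∀ dX dZ x → glueμ dX dZ (f x) ≡ dX x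
  glueμ-f dX dZ x with g (f x) Z.≟ Z.0#
  ... | yes gfx≡0 = cong dX (preimage-f x gfx≡0)
  ... | no gfx≢0  = ⊥-elim (gfx≢0 (im⊆ker x))

  glueμ-off-kernel : ∀ dX dZ y → g y ≢ Z.0# → glueμ dX dZ y ≡ dZ (g y)
  glueμ-off-kernel dX dZ y gy≢0 with g y Z.≟ Z.0#
  ... | yes gy≡0 = ⊥-elim (gy≢0 gy≡0)
  ... | no _     = refl

  weight-glue-f : ∀ s t dX dZ x → AY.weight (glue s t) (glueμ dX dZ) (f x) ≡ AX.weight s dX x
  weight-glue-f s t dX dZ x = whenμ-resp (isRep? Y (glue s t) (f x)) (isRep? X s x)
    (λ (fx≢0 , glued≡fx) → f≢0⇒≢0 fx≢0 , f-inj _ _ (trans (sym (glue-f s t x)) glued≡fx))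
    (λ (x≢0 , sx≡x) → f-≢0 x≢0 , trans (glue-f s t x) (cong f sx≡x))
    (λ _ → glueμ-f dX dZ x)

  weight-glue-off-kernel : ∀ s t dX dZ y → g y ≢ Z.0# →
                           AY.weight (glue s t) (glueμ dX dZ) y ≡ AZ.weight t dZ (g y)
  weight-glue-off-kernel s t dX dZ y gy≢0 = whenμ-resp (isRep? Y (glue s t) y) (isRep? Z t (g y))
    (λ (_ , glued≡y) → gy≢0 , (begin
      sec t (g y)                       ≡⟨ AZ.exponent-spec t (g y) ⟩
      Z.act (AZ.exponent t (g y)) (g y) ≡⟨ g-equiv _ y ⟨
      g (Y.act (AZ.exponent t (g y)) y) ≡⟨ cong g (glue-off-kernel s t y gy≢0) ⟨
      g (sec (glue s t) y)              ≡⟨ cong g glued≡y ⟩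
      g y                               ∎))
    (λ (_ , tgy≡gy) → g≢0⇒≢0 gy≢0 , (begin
      sec (glue s t) y              ≡⟨ glue-off-kernel s t y gy≢0 ⟩
      Y.act (AZ.exponent t (g y)) y
        ≡⟨ cong (λ ζ → Y.act ζ y) (Z.act-free _ _ gy≢0 (trans (sym (AZ.exponent-spec t (g y))) tgy≡gy)) ⟩
      Y.act 1μ y                    ≡⟨ Y.act-unit y ⟩
      y                             ∎))
    (λ _ → glueμ-off-kernel dX dZ y gy≢0)
    where open ≡-Reasoning

  weight-glue-fibre : ∀ s t dX dZ z (z≟0 : Dec (z ≡ Z.0#)) →
                      AX.∏ (λ x → AY.weight (glue s t) (glueμ dX dZ) (assemble z x)) ≡
                      whenμ z≟0 (prodOverOrbits X s dX) ·μ AZ.weight t dZ z ^μ X.size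
  weight-glue-fibre s t dX dZ z (yes z≡0) = begin
    AX.∏ (λ x → wY (assemble z x)) ≡⟨ AX.∏-cong over-0 ⟩
    AX.∏ (AX.weight s dX)          ≡⟨ AX.prodOverOrbits≡∏weight s dX ⟨
    PX                             ≡⟨ ·μ-identityʳ PX ⟨
    PX ·μ 1μ                       ≡⟨ cong (PX ·μ_) (prodμ-1 X.size) ⟨
    PX ·μ 1μ ^μ X.size             ≡⟨ cong (λ a → PX ·μ a ^μ X.size) (trans (cong wZ z≡0) (AZ.weight-0 t dZ)) ⟨
    PX ·μ wZ z ^μ X.size           ∎
    where
      open ≡-Reasoning
      wY = AY.weight (glue s t) (glueμ dX dZ)
      wZ = AZ.weight t dZ
      PX = prodOverOrbits X s dX
      over-0 : ∀ x → wY (assemble z x) ≡ AX.weight s dX x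
      over-0 x = begin
        wY (assemble z x)    ≡⟨ cong (λ z′ → wY (assemble z′ x)) z≡0 ⟩
        wY (assemble Z.0# x) ≡⟨ cong wY (assemble-0 x) ⟩
        wY (f x)             ≡⟨ weight-glue-f s t dX dZ x ⟩
        AX.weight s dX x     ∎
  weight-glue-fibre s t dX dZ z (no z≢0) = begin
    AX.∏ (λ x → wY (assemble z x)) ≡⟨ AX.∏-cong over-z ⟩
    wZ z ^μ X.size                 ≡⟨ ·μ-identityˡ _ ⟨
    1μ ·μ wZ z ^μ X.size           ∎
    where
      open ≡-Reasoning
      wY = AY.weight (glue s t) (glueμ dX dZ)
      wZ = AZ.weight t dZ
      over-z : ∀ x → wY (assemble z x) ≡ wZ z
      over-z x = trans (weight-glue-off-kernel s t dX dZ (assemble z x) (λ eq → z≢0 (trans (sym (g-assemble z x)) eq)))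
                       (cong wZ (g-assemble z x))

  prodOverOrbits-glue : ∀ s t dX dZ → prodOverOrbits Y (glue s t) (glueμ dX dZ) ≡
                                      prodOverOrbits X s dX ·μ prodOverOrbits Z t dZ
  prodOverOrbits-glue s t dX dZ = begin
    prodOverOrbits Y (glue s t) (glueμ dX dZ)   ≡⟨ AY.prodOverOrbits≡∏weight _ _ ⟩
    AY.∏ wY                                     ≡⟨ ∏Y-decompose wY ⟩
    AZ.∏ (λ z → AX.∏ (λ x → wY (assemble z x))) ≡⟨ AZ.∏-cong (λ z → weight-glue-fibre s t dX dZ z (z Z.≟ Z.0#)) ⟩
    AZ.∏ (λ z → whenμ (z Z.≟ Z.0#) PX ·μ wZ z ^μ X.size)
      ≡⟨ AZ.∏-distrib (λ z → whenμ (z Z.≟ Z.0#) PX) (λ z → wZ z ^μ X.size) ⟩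
    AZ.∏ (λ z → whenμ (z Z.≟ Z.0#) PX) ·μ AZ.∏ (λ z → wZ z ^μ X.size)
      ≡⟨ cong₂ _·μ_ (AZ.∏-indicator Z.0# PX) (prodμ-^μ Z.size X.size _) ⟩
    PX ·μ AZ.∏ wZ ^μ X.size                     ≡⟨ cong (PX ·μ_) (AX.^μ-size (AZ.∏ wZ)) ⟩
    PX ·μ AZ.∏ wZ                               ≡⟨ cong (PX ·μ_) (AZ.prodOverOrbits≡∏weight t dZ) ⟨
    PX ·μ prodOverOrbits Z t dZ                 ∎
    where
      open ≡-Reasoning
      wY = AY.weight (glue s t) (glueμ dX dZ)
      wZ = AZ.weight t dZ
      PX = prodOverOrbits X s dX

  glued-transition : ∀ s s′ t t′ y r →
    glued s′ t′ y r ≡ Y.act (glueμAt (AX.transition s s′) (AZ.transition t t′) y r) (glued s t y r)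
  glued-transition s s′ t t′ y (yes gy≡0) =
    trans (cong f (AX.transition-spec s s′ _)) (f-equiv _ _)
  glued-transition s s′ t t′ y (no gy≢0) =
    trans (act-cancel-over y gy≢0 (begin
      Z.act (AZ.exponent t′ (g y)) (g y)                                   ≡⟨ AZ.exponent-spec t′ (g y) ⟨
      sec t′ (g y)                                                         ≡⟨ AZ.transition-spec t t′ (g y) ⟩
      Z.act (AZ.transition t t′ (g y)) (sec t (g y))                       ≡⟨ cong (Z.act _) (AZ.exponent-spec t (g y)) ⟩
      Z.act (AZ.transition t t′ (g y)) (Z.act (AZ.exponent t (g y)) (g y)) ≡⟨ Z.act-comp _ _ _ ⟨
      Z.act (AZ.transition t t′ (g y) ·μ AZ.exponent t (g y)) (g y)        ∎))
      (Y.act-comp _ _ y)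
    where open ≡-Reasoning

  δ-glue : ∀ s s′ t t′ → AY.δ (glue s t) (glue s′ t′) ≡ AX.δ s s′ ·μ AZ.δ t t′
  δ-glue s s′ t t′ = trans (AY.prodOverOrbits-cong (glue s t) agree)
                           (prodOverOrbits-glue s t (AX.transition s s′) (AZ.transition t t′))
    where
      agree : ∀ y → y ≢ Y.0# → AY.transition (glue s t) (glue s′ t′) y ≡
                               glueμ (AX.transition s s′) (AZ.transition t t′) y
      agree y y≢0 = sym (AY.transition-unique (glue s t) (glue s′ t′) _
        (λ y′ → glued-transition s s′ t t′ y′ (g y′ Z.≟ Z.0#)) y y≢0)

module DetIsomorphism {n : ℕ} .{{_ : NonZero n}} (E : SES n) where
  open ShortExact E

  t₀ : Section Z
  t₀ = AZ.someSection

  toDet : Maybe (DetLine X × DetLine Z) → Maybe (DetLine Y)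
  toDet nothing                    = nothing
  toDet (just ((ζ , s) , (ξ , t))) = just (ζ ·μ ξ , glue s t)

  -- (ζ , u) ≈ (ζ · δ (glue (restrict u) t₀) u , glue (restrict u) t₀), which toDet hits.
  fromDet : Maybe (DetLine Y) → Maybe (DetLine X × DetLine Z)
  fromDet nothing        = nothing
  fromDet (just (ζ , u)) = just ((ζ ·μ AY.δ (glue (restrict u) t₀) u , restrict u) , (1μ , t₀))

  open CommutativeMonoidSolver (μ-commutativeMonoid {n}) using (solve; _⊕_; _⊜_)
  private
    module ⊗ = PtMuSetoid (X ⊗Det Z)
    module D = PtMuSetoid (Det Y)

  toDet-cong : ∀ {a a′} → a ⊗.≈ a′ → toDet a D.≈ toDet a′
  toDet-cong {nothing} {nothing} _ = tt
  toDet-cong {just ((ζ , s) , (ξ , t))} {just ((ζ′ , s′) , (ξ′ , t′))} (η , a′≈ηa , b≈ηb′) =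
    AY.≡·δ⇒≈Line (ζ ·μ ξ) (glue s t) (ζ′ ·μ ξ′) (glue s′ t′) (sym (begin
      (ζ′ ·μ ξ′) ·μ AY.δ (glue s t) (glue s′ t′)
        ≡⟨ cong₂ (λ u v → (u ·μ ξ′) ·μ v) ζ′≡ (δ-glue s s′ t t′) ⟩
      (((η ·μ ζ) ·μ AX.δ s′ s) ·μ ξ′) ·μ (AX.δ s s′ ·μ AZ.δ t t′)
        ≡⟨ solve 6 (λ a b c d e h → (((a ⊕ b) ⊕ c) ⊕ d) ⊕ (e ⊕ h) ⊜ b ⊕ (((a ⊕ d) ⊕ h) ⊕ (c ⊕ e)))
                   refl η ζ (AX.δ s′ s) ξ′ (AX.δ s s′) (AZ.δ t t′) ⟩
      ζ ·μ (((η ·μ ξ′) ·μ AZ.δ t t′) ·μ (AX.δ s′ s ·μ AX.δ s s′))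
        ≡⟨ cong₂ (λ u v → ζ ·μ (u ·μ v)) (sym ξ≡) (AX.δ-sym s s′) ⟩
      ζ ·μ (ξ ·μ 1μ)
        ≡⟨ cong (ζ ·μ_) (·μ-identityʳ ξ) ⟩
      ζ ·μ ξ
        ∎))
    where
      open ≡-Reasoning
      ζ′≡ : ζ′ ≡ (η ·μ ζ) ·μ AX.δ s′ s
      ζ′≡ = AX.≈Line⇒≡·δ ζ′ s′ (η ·μ ζ) s a′≈ηa
      ξ≡ : ξ ≡ (η ·μ ξ′) ·μ AZ.δ t t′
      ξ≡ = AZ.≈Line⇒≡·δ ξ t (η ·μ ξ′) t′ b≈ηb′

  fromDet-cong : ∀ {b b′} → b D.≈ b′ → fromDet b ⊗.≈ fromDet b′
  fromDet-cong {nothing} {nothing} _ = tt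
  fromDet-cong {just (ζ , u)} {just (ζ′ , u′)} u≈u′ =
    1μ , AX.≡·δ⇒≈Line _ s′ _ s ζ′-side , AZ.≡·δ⇒≈Line 1μ t₀ (1μ ·μ 1μ) t₀ t₀-side
    where
      open ≡-Reasoning
      s = restrict u
      s′ = restrict u′
      D = AY.δ (glue s t₀) u
      D′ = AY.δ (glue s′ t₀) u′
      ζ≡ : ζ ≡ ζ′ ·μ AY.δ u u′
      ζ≡ = AY.≈Line⇒≡·δ ζ u ζ′ u′ u≈u′
      D′≡ : D′ ≡ AX.δ s′ s ·μ (D ·μ AY.δ u u′)
      D′≡ = begin
        D′
          ≡⟨ AY.δ-trans (glue s′ t₀) (glue s t₀) u′ ⟩
        AY.δ (glue s′ t₀) (glue s t₀) ·μ AY.δ (glue s t₀) u′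
          ≡⟨ cong₂ _·μ_ (δ-glue s′ s t₀ t₀) (AY.δ-trans (glue s t₀) u u′) ⟩
        (AX.δ s′ s ·μ AZ.δ t₀ t₀) ·μ (D ·μ AY.δ u u′)
          ≡⟨ cong (λ v → (AX.δ s′ s ·μ v) ·μ (D ·μ AY.δ u u′)) (AZ.δ-refl t₀) ⟩
        (AX.δ s′ s ·μ 1μ) ·μ (D ·μ AY.δ u u′)
          ≡⟨ cong (_·μ (D ·μ AY.δ u u′)) (·μ-identityʳ _) ⟩
        AX.δ s′ s ·μ (D ·μ AY.δ u u′)
          ∎
      ζ′-side : ζ′ ·μ D′ ≡ (1μ ·μ (ζ ·μ D)) ·μ AX.δ s′ s
      ζ′-side = begin
        ζ′ ·μ D′                              ≡⟨ cong (ζ′ ·μ_) D′≡ ⟩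
        ζ′ ·μ (AX.δ s′ s ·μ (D ·μ AY.δ u u′))
          ≡⟨ solve 4 (λ a b c d → a ⊕ (b ⊕ (c ⊕ d)) ⊜ ((a ⊕ d) ⊕ c) ⊕ b) refl ζ′ (AX.δ s′ s) D (AY.δ u u′) ⟩
        ((ζ′ ·μ AY.δ u u′) ·μ D) ·μ AX.δ s′ s ≡⟨ cong (λ v → (v ·μ D) ·μ AX.δ s′ s) ζ≡ ⟨
        (ζ ·μ D) ·μ AX.δ s′ s                 ≡⟨ cong (_·μ AX.δ s′ s) (·μ-identityˡ _) ⟨
        (1μ ·μ (ζ ·μ D)) ·μ AX.δ s′ s         ∎
      t₀-side : 1μ ≡ (1μ ·μ 1μ) ·μ AZ.δ t₀ t₀
      t₀-side = sym (trans (cong ((1μ ·μ 1μ) ·μ_) (AZ.δ-refl t₀)) (trans (·μ-identityʳ _) (·μ-identityʳ _)))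

  toDet-fromDet : ∀ b → toDet (fromDet b) D.≈ b
  toDet-fromDet nothing        = tt
  toDet-fromDet (just (ζ , u)) = AY.≡·δ⇒≈Line _ (glue (restrict u) t₀) ζ u (·μ-identityʳ _)

  fromDet-toDet : ∀ a → fromDet (toDet a) ⊗.≈ a
  fromDet-toDet nothing = tt
  fromDet-toDet (just ((ζ , s) , (ξ , t))) =
    η , AX.≡·δ⇒≈Line ζ s _ s′ ζ-side , AZ.≡·δ⇒≈Line 1μ t₀ (η ·μ ξ) t t-side
    where
      open ≡-Reasoning
      s′ = restrict (glue s t)
      D = AY.δ (glue s′ t₀) (glue s t)
      η = μ⁻¹ (ξ ·μ AZ.δ t₀ t)
      D≡ : D ≡ AZ.δ t₀ t
      D≡ = trans (δ-glue s′ s t₀ t)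
             (trans (cong (_·μ AZ.δ t₀ t) (AX.δ-pointwise s′ s (restrict-glue s t))) (·μ-identityˡ _))
      ζ-side : ζ ≡ (η ·μ ((ζ ·μ ξ) ·μ D)) ·μ AX.δ s s′
      ζ-side = sym (begin
        (η ·μ ((ζ ·μ ξ) ·μ D)) ·μ AX.δ s s′
          ≡⟨ cong₂ (λ a b → (η ·μ ((ζ ·μ ξ) ·μ a)) ·μ b) D≡ (AX.δ-pointwise s s′ (λ x → sym (restrict-glue s t x))) ⟩
        (η ·μ ((ζ ·μ ξ) ·μ AZ.δ t₀ t)) ·μ 1μ ≡⟨ ·μ-identityʳ _ ⟩
        η ·μ ((ζ ·μ ξ) ·μ AZ.δ t₀ t)
          ≡⟨ solve 4 (λ a b c d → a ⊕ ((b ⊕ c) ⊕ d) ⊜ b ⊕ (a ⊕ (c ⊕ d))) refl η ζ ξ (AZ.δ t₀ t) ⟩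
        ζ ·μ (η ·μ (ξ ·μ AZ.δ t₀ t))         ≡⟨ cong (ζ ·μ_) (·μ-inverseˡ _) ⟩
        ζ ·μ 1μ                              ≡⟨ ·μ-identityʳ ζ ⟩
        ζ                                    ∎)
      t-side : 1μ ≡ (η ·μ ξ) ·μ AZ.δ t₀ t
      t-side = sym (trans (·μ-assoc _ _ _) (·μ-inverseˡ _))

  toDet-equivariant : ∀ ζ a → toDet (⊗.actE ζ a) D.≈ D.actE ζ (toDet a)
  toDet-equivariant ζ nothing = tt
  toDet-equivariant ζ (just ((ζ₁ , s) , (ζ₂ , t))) =
    AY.≡·δ⇒≈Line ((ζ ·μ ζ₁) ·μ ζ₂) (glue s t) (ζ ·μ (ζ₁ ·μ ζ₂)) (glue s t) (begin
    (ζ ·μ ζ₁) ·μ ζ₂                                 ≡⟨ ·μ-assoc ζ ζ₁ ζ₂ ⟩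
    ζ ·μ (ζ₁ ·μ ζ₂)                                 ≡⟨ ·μ-identityʳ _ ⟨
    (ζ ·μ (ζ₁ ·μ ζ₂)) ·μ 1μ                         ≡⟨ cong ((ζ ·μ (ζ₁ ·μ ζ₂)) ·μ_) (AY.δ-refl (glue s t)) ⟨
    (ζ ·μ (ζ₁ ·μ ζ₂)) ·μ AY.δ (glue s t) (glue s t) ∎)
    where open ≡-Reasoning

  detIso : PtMuIso (X ⊗Det Z) (Det Y)
  detIso = record
    { to        = toDet
    ; from      = fromDet
    ; to-cong   = λ {a} {a′} → toDet-cong {a} {a′}
    ; from-cong = λ {b} {b′} → fromDet-cong {b} {b′}
    ; to-from   = toDet-fromDet
    ; from-to   = fromDet-toDet
    ; to-pt     = tt
    ; to-equiv  = toDet-equivariant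
    }

module Naturality {n : ℕ} .{{_ : NonZero n}} {E E′ : SES n} (φ : SESIso E E′) where
  module E = ShortExact E
  module E′ = ShortExact E′
  private
    module ΦE = DetIsomorphism E
    module ΦE′ = DetIsomorphism E′
  open SESIso φ
  module α = MuGroupIso α
  module β = MuGroupIso β
  module γ = MuGroupIso γ

  γ-0 : γ.to E.Z.0# ≡ E′.Z.0#
  γ-0 = +-homo⇒0-homo E.Z E′.Z γ.to γ.to-hom

  γ-injective : ∀ {z z′} → γ.to z ≡ γ.to z′ → z ≡ z′
  γ-injective {z} {z′} eq = trans (sym (γ.from-to z)) (trans (cong γ.from eq) (γ.from-to z′))

  module _ (s : Section E.X) (t : Section E.Z) where
    private
      sα = transportSection α s
      tγ = transportSection γ t

    glued-transport : ∀ y′ (r : Dec (E.g (β.from y′) ≡ E.Z.0#)) (r′ : Dec (E′.g y′ ≡ E′.Z.0#)) →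
                      β.to (E.glued s t (β.from y′) r) ≡ E′.glued sα tγ y′ r′
    glued-transport y′ = compare
      where
        y = β.from y′
        g′y′≡γgy : E′.g y′ ≡ γ.to (E.g y)
        g′y′≡γgy = trans (cong E′.g (sym (β.to-from y′))) (sq-g y)
        compare : ∀ r r′ → β.to (E.glued s t y r) ≡ E′.glued sα tγ y′ r′
        compare (yes gy≡0) (yes g′y′≡0) =
          trans (sym (sq-f _)) (cong (λ x → E′.f (α.to (sec s x))) (sym same-preimage))
          where
            same-preimage : α.from (E′.preimage y′ g′y′≡0) ≡ E.preimage y gy≡0
            same-preimage = trans (cong α.from (E′.f-inj _ _ (begin
              E′.f (E′.preimage y′ g′y′≡0)   ≡⟨ E′.f-preimage y′ g′y′≡0 ⟩
              y′                             ≡⟨ β.to-from y′ ⟨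
              β.to y                         ≡⟨ cong β.to (E.f-preimage y gy≡0) ⟨
              β.to (E.f (E.preimage y gy≡0)) ≡⟨ sq-f _ ⟨
              E′.f (α.to (E.preimage y gy≡0)) ∎))) (α.from-to _)
              where open ≡-Reasoning
        compare (yes gy≡0) (no g′y′≢0) = ⊥-elim (g′y′≢0 (trans g′y′≡γgy (trans (cong γ.to gy≡0) γ-0)))
        compare (no gy≢0) (yes g′y′≡0) =
          ⊥-elim (gy≢0 (γ-injective (trans (sym g′y′≡γgy) (trans g′y′≡0 (sym γ-0)))))
        compare (no gy≢0) (no g′y′≢0) = begin
          β.to (E.Y.act (E.AZ.exponent t (E.g y)) y)  ≡⟨ β.to-equiv _ y ⟩
          E′.Y.act (E.AZ.exponent t (E.g y)) (β.to y) ≡⟨ cong (E′.Y.act _) (β.to-from y′) ⟩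
          E′.Y.act (E.AZ.exponent t (E.g y)) y′       ≡⟨ E′.act-cancel-over y′ g′y′≢0 same-exponent ⟩
          E′.Y.act (E′.AZ.exponent tγ (E′.g y′)) y′   ∎
          where
            open ≡-Reasoning
            same-exponent : E′.Z.act (E.AZ.exponent t (E.g y)) (E′.g y′) ≡
                            E′.Z.act (E′.AZ.exponent tγ (E′.g y′)) (E′.g y′)
            same-exponent = sym (begin
              E′.Z.act (E′.AZ.exponent tγ (E′.g y′)) (E′.g y′)  ≡⟨ E′.AZ.exponent-spec tγ _ ⟨
              γ.to (sec t (γ.from (E′.g y′)))                   ≡⟨ cong (λ z → γ.to (sec t (γ.from z))) g′y′≡γgy ⟩
              γ.to (sec t (γ.from (γ.to (E.g y))))              ≡⟨ cong (λ z → γ.to (sec t z)) (γ.from-to _) ⟩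
              γ.to (sec t (E.g y))                              ≡⟨ cong γ.to (E.AZ.exponent-spec t _) ⟩
              γ.to (E.Z.act (E.AZ.exponent t (E.g y)) (E.g y))  ≡⟨ γ.to-equiv _ _ ⟩
              E′.Z.act (E.AZ.exponent t (E.g y)) (γ.to (E.g y)) ≡⟨ cong (E′.Z.act _) g′y′≡γgy ⟨
              E′.Z.act (E.AZ.exponent t (E.g y)) (E′.g y′)      ∎)

    transport-glue : ∀ y′ → sec (transportSection β (E.glue s t)) y′ ≡ sec (E′.glue sα tγ) y′
    transport-glue y′ = glued-transport y′ (E.g (β.from y′) E.Z.≟ E.Z.0#) (E′.g y′ E′.Z.≟ E′.Z.0#)

  detIso-natural : ∀ u → MaybeRel (_≈Line_ E′.Y)
                           (detMap β (PtMuIso.to ΦE.detIso u))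
                           (PtMuIso.to ΦE′.detIso (tensorDetMap α γ u))
  detIso-natural nothing = tt
  detIso-natural (just ((ζ , s) , (ξ , t))) = E′.AY.≡·δ⇒≈Line (ζ ·μ ξ) u (ζ ·μ ξ) u′ (begin
    ζ ·μ ξ                   ≡⟨ ·μ-identityʳ (ζ ·μ ξ) ⟨
    (ζ ·μ ξ) ·μ 1μ           ≡⟨ cong ((ζ ·μ ξ) ·μ_) (E′.AY.δ-pointwise u u′ (transport-glue s t)) ⟨
    (ζ ·μ ξ) ·μ E′.AY.δ u u′ ∎)
    where
      open ≡-Reasoning
      u = transportSection β (E.glue s t)
      u′ = E′.glue (transportSection α s) (transportSection γ t)

mainTheorem13 : (n : ℕ) .{{nz : NonZero n}} → CanonicalDetIso n
mainTheorem13 n = DetIsomorphism.detIso , λ E E′ φ → Naturality.detIso-natural φ
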